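{- Let $d,m,s\in\mathbb{N}$, let $A=(I_d\ \ 0)\in\mathbb{Z}^{d\times(d+1)}$, let $B\in\mathbb{Z}^{s\times(d+1)}$, and let $\mathcal{A}$ be the $n$-fold matrix with $m$ copies of $A$ in the top block row and $m$ copies of $B$ on the block diagonal, i.e. $\mathcal{A}x=b$ means $\sum_{i=1}^m Ax^i=b^0$ and $Bx^i=b^i$ for $i\in[m]$, where $x=(x^1,\dots,x^m)$, $x^i\in\mathbb{Z}^{d+1}$. Let $b=(b^0,b^1,\dots,b^m)\in\mathbb{Z}_{\ge0}^{d+sm}$ with $b^1=b^2=\dots=b^m$. If $\mathcal{A}x=b$ has a solution $x\in\mathbb{Z}_{\ge0}^{m(d+1)}$, then it has a solution $x=(x^1,\dots,x^m)\in\mathbb{Z}_{\ge0}^{m(d+1)}$ with $\|x^i-x^{i'}\|_\infty\leq 2d\,g_\infty(B)$ for all $i,i'\in[m]$.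
   Context: For vectors $u,v\in\mathbb{Z}^k$, $u\sqsubseteq v$ means $u_jv_j\ge0$ and $|u_j|\le|v_j|$ for all $j$. The Graver basis of $B$ is the set of $\sqsubseteq$-minimal nonzero elements of $\{y\in\mathbb{Z}^{d+1}\mid By=0\}$, and $g_\infty(B)$ denotes an upper bound on the $\ell_\infty$-norm of the elements of the Graver basis of $B$. -}

module Defs where

open import Data.Nat using (ℕ; zero; suc)
open import Data.Integer using (ℤ; +_; _+_; _-_; _*_; ∣_∣; _≤_; 0ℤ)
import Data.Nat as ℕ
open import Data.Fin using (Fin; zero; suc; toℕ; inject₁; fromℕ)
open import Data.Product using (_×_)
open import Relation.Binary.PropositionalEquality using (_≡_)
open import Relation.Nullary using (¬_)

Vecℤ : ℕ → Set
Vecℤ k = Fin k → ℤ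

Matℤ : ℕ → ℕ → Set
Matℤ r c = Fin r → Fin c → ℤ

sumFin : {n : ℕ} → (Fin n → ℤ) → ℤ
sumFin {zero}  f = 0ℤ
sumFin {suc n} f = f zero + sumFin (λ i → f (suc i))

_·ᵥ_ : {r c : ℕ} → Matℤ r c → Vecℤ c → Vecℤ r
(M ·ᵥ y) k = sumFin (λ j → M k j * y j)

InKernel : {r c : ℕ} → Matℤ r c → Vecℤ c → Set
InKernel M y = ∀ k → (M ·ᵥ y) k ≡ 0ℤ

NonZeroVec : {c : ℕ} → Vecℤ c → Set
NonZeroVec y = ¬ (∀ j → y j ≡ 0ℤ)

_⊑_ : {c : ℕ} → Vecℤ c → Vecℤ c → Set
u ⊑ v = ∀ j → (0ℤ ≤ u j * v j) × (∣ u j ∣ ℕ.≤ ∣ v j ∣)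

InGraver : {r c : ℕ} → Matℤ r c → Vecℤ c → Set
InGraver M y =
  InKernel M y × NonZeroVec y ×
  (∀ z → InKernel M z → NonZeroVec z → z ⊑ y → ∀ j → z j ≡ y j)

NormInfLe : {c : ℕ} → Vecℤ c → ℕ → Set
NormInfLe v g = ∀ j → ∣ v j ∣ ℕ.≤ g

-- g is an upper bound on the ℓ∞ norm of all Graver basis elements of M
-- (i.e. g is a valid value of g_∞(M))
GraverInfBound : {r c : ℕ} → Matℤ r c → ℕ → Set
GraverInfBound M g = ∀ y → InGraver M y → NormInfLe y g

NonNeg : {c : ℕ} → Vecℤ c → Set
NonNeg v = ∀ j → 0ℤ ≤ v j

-- the n-fold system  𝒜 x = (b⁰, c, c, …, c)  with A = (I_d 0):
--   Σ_i (x^i)_j = b⁰_j for j < d   and   B x^i = c for every i ∈ [m]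
NFoldSolution : (d m s : ℕ) → Matℤ s (suc d) → Vecℤ d → Vecℤ s
              → (Fin m → Vecℤ (suc d)) → Set
NFoldSolution d m s B b0 c x =
  (∀ (j : Fin d) → sumFin (λ i → x i (inject₁ j)) ≡ b0 j) ×
  (∀ (i : Fin m) → ∀ k → (B ·ᵥ x i) k ≡ c k)

{-# OPTIONS --safe #-}

-- Descend along the potential Φ x = Σᵢ ‖xⁱ‖². If |xⁱⱼ - xⁱ′ⱼ| > g, then v = xⁱ - xⁱ′ lies in
-- ker B but is not a Graver element, so it has a proper conformal kernel part; descending
-- through such parts that keep the j-th entry, one finds h ⊑ v in ker B that is not just v
-- restricted to a subset of its support. Replacing xⁱ, xⁱ′ by xⁱ - h, xⁱ′ + h keeps the
-- solution nonnegative (h ⊑ v), keeps Σᵢ xⁱ and every B xⁱ, and lowers Φ by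
-- 2 Σⱼ hⱼ (vⱼ - hⱼ) > 0. So the blocks end up within g ≤ 2dg of each other when d ≥ 1; for
-- d = 0 the top block row is empty and all blocks may be taken equal.

module Submission where

open import Defs
open import Data.Nat using (ℕ; zero; suc; z≤n; s≤s)
import Data.Nat as ℕ
import Data.Nat.Properties as ℕP
open import Data.Nat.Induction using (<-wellFounded)
open import Data.Integer
  using (ℤ; +_; -[1+_]; _+_; _-_; _*_; -_; ∣_∣; 0ℤ; _≤_; _<_; +≤+; -≤+; -≤-; +<+; sign; _◃_; nonNegative)
import Data.Integer.Properties as ℤP
open import Data.Integer.Tactic.RingSolver using (solve-∀)
open import Data.Fin using (Fin; zero; suc; toℕ; fromℕ<; inject₁)
import Data.Fin.Properties as FinP
open import Data.Vec.Functional using (Vector; []; _∷_; updateAt)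
open import Data.Vec.Functional.Properties using (updateAt-minimal; ≗-dec)
open import Data.Product using (Σ; _×_; _,_; proj₁; proj₂; ∃-syntax)
open import Data.Sum using (_⊎_; inj₁; inj₂; [_,_]′)
open import Data.Empty using (⊥-elim)
open import Function using (_∘_; id)
open import Induction.WellFounded using (Acc; acc)
open import Relation.Nullary using (¬_; Dec; yes; no)
open import Relation.Nullary.Decidable using (map′; ¬?; _×-dec_; _⊎-dec_; decidable-stable)
open import Relation.Unary using (Decidable)
open import Relation.Binary.PropositionalEquality
  using (_≡_; _≢_; _≗_; refl; sym; trans; cong; cong₂; subst; module ≡-Reasoning)
open import Algebra.Properties.CommutativeSemigroup ℤP.+-commutativeSemigroup using (interchange)
open import Algebra.Properties.Monoid.Sum ℕP.+-0-monoid using (sum)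

sumFin-cong : ∀ {n} {f g : Fin n → ℤ} → f ≗ g → sumFin f ≡ sumFin g
sumFin-cong {zero}  f≗g = refl
sumFin-cong {suc n} f≗g = cong₂ _+_ (f≗g zero) (sumFin-cong (f≗g ∘ suc))

sumFin-+ : ∀ {n} (f g : Fin n → ℤ) → sumFin (λ k → f k + g k) ≡ sumFin f + sumFin g
sumFin-+ {zero}  f g = refl
sumFin-+ {suc n} f g =
  trans (cong (_+_ (f zero + g zero)) (sumFin-+ (f ∘ suc) (g ∘ suc)))
        (interchange (f zero) (g zero) (sumFin (f ∘ suc)) (sumFin (g ∘ suc)))

sumFin-- : ∀ {n} (f g : Fin n → ℤ) → sumFin (λ k → f k - g k) ≡ sumFin f - sumFin g
sumFin-- {zero}  f g = refl
sumFin-- {suc n} f g =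
  trans (cong (_+_ (f zero - g zero)) (sumFin-- (f ∘ suc) (g ∘ suc)))
        (regroup (f zero) (g zero) (sumFin (f ∘ suc)) (sumFin (g ∘ suc)))
  where
  regroup : ∀ a b c d → (a - b) + (c - d) ≡ (a + c) - (b + d)
  regroup = solve-∀

sumFin-nonNeg : ∀ {n} (f : Fin n → ℤ) → (∀ k → 0ℤ ≤ f k) → 0ℤ ≤ sumFin f
sumFin-nonNeg {zero}  f f≥0 = +≤+ z≤n
sumFin-nonNeg {suc n} f f≥0 = ℤP.+-mono-≤ (f≥0 zero) (sumFin-nonNeg (f ∘ suc) (f≥0 ∘ suc))

sumFin-pos : ∀ {n} (f : Fin n → ℤ) → (∀ k → 0ℤ ≤ f k) → ∀ k → 0ℤ < f k → 0ℤ < sumFin f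
sumFin-pos {suc n} f f≥0 zero    fk>0 =
  ℤP.+-mono-<-≤ fk>0 (sumFin-nonNeg (f ∘ suc) (f≥0 ∘ suc))
sumFin-pos {suc n} f f≥0 (suc k) fk>0 =
  ℤP.+-mono-≤-< (f≥0 zero) (sumFin-pos (f ∘ suc) (f≥0 ∘ suc) k fk>0)

sumFin-updateAt : ∀ {a} {A : Set a} {n} (F : A → ℤ) (xs : Vector A n) i (f : A → A) →
                  sumFin (F ∘ xs) ≡ sumFin (F ∘ updateAt xs i f) + (F (xs i) - F (f (xs i)))
sumFin-updateAt F xs zero    f = swap-head (F (xs zero)) (F (f (xs zero))) (sumFin (F ∘ xs ∘ suc))
  where
  swap-head : ∀ a b s → a + s ≡ (b + s) + (a - b)
  swap-head = solve-∀
sumFin-updateAt F xs (suc i) f =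
  trans (cong (_+_ (F (xs zero))) (sumFin-updateAt F (xs ∘ suc) i f))
        (sym (ℤP.+-assoc (F (xs zero)) (sumFin (F ∘ updateAt (xs ∘ suc) i f)) _))

sum-mono-≤ : ∀ {n} {f g : Fin n → ℕ} → (∀ k → f k ℕ.≤ g k) → sum f ℕ.≤ sum g
sum-mono-≤ {zero}  f≤g = z≤n
sum-mono-≤ {suc n} f≤g = ℕP.+-mono-≤ (f≤g zero) (sum-mono-≤ (f≤g ∘ suc))

sum-mono-< : ∀ {n} {f g : Fin n → ℕ} → (∀ k → f k ℕ.≤ g k) → ∀ k → f k ℕ.< g k → sum f ℕ.< sum g
sum-mono-< f≤g zero    fk<gk = ℕP.+-mono-<-≤ fk<gk (sum-mono-≤ (f≤g ∘ suc))
sum-mono-< f≤g (suc k) fk<gk = ℕP.+-mono-≤-< (f≤g zero) (sum-mono-< (f≤g ∘ suc) k fk<gk)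

∣∣-mono-<-nonNeg : ∀ {a b} → 0ℤ ≤ a → a < b → ∣ a ∣ ℕ.< ∣ b ∣
∣∣-mono-<-nonNeg (+≤+ _) (+<+ p<q) = p<q

_+ᵥ_ _-ᵥ_ : ∀ {n} → Vecℤ n → Vecℤ n → Vecℤ n
(u +ᵥ w) j = u j + w j
(u -ᵥ w) j = u j - w j

updateAt-All : ∀ {a p} {A : Set a} (P : A → Set p) {n} (xs : Vector A n) i {f : A → A} →
               (∀ k → P (xs k)) → P (f (xs i)) → ∀ k → P (updateAt xs i f k)
updateAt-All P xs zero    Pxs Pfxi zero    = Pfxi
updateAt-All P xs zero    Pxs Pfxi (suc k) = Pxs (suc k)
updateAt-All P xs (suc i) Pxs Pfxi zero    = Pxs zero
updateAt-All P xs (suc i) Pxs Pfxi (suc k) = updateAt-All P (xs ∘ suc) i (Pxs ∘ suc) Pfxi k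

‖_‖₁ : ∀ {n} → Vecℤ n → ℕ
‖ w ‖₁ = sum (λ k → ∣ w k ∣)

‖_‖² : ∀ {n} → Vecℤ n → ℤ
‖ w ‖² = sumFin (λ k → w k * w k)

‖‖²-- : ∀ {n} (u w : Vecℤ n) → ‖ u ‖² - ‖ w ‖² ≡ sumFin (λ k → u k * u k - w k * w k)
‖‖²-- u w = sym (sumFin-- (λ k → u k * u k) (λ k → w k * w k))

·ᵥ-+ : ∀ {r c} (M : Matℤ r c) u w k → (M ·ᵥ (u +ᵥ w)) k ≡ (M ·ᵥ u) k + (M ·ᵥ w) k
·ᵥ-+ M u w k =
  trans (sumFin-cong (λ j → ℤP.*-distribˡ-+ (M k j) (u j) (w j)))
        (sumFin-+ (λ j → M k j * u j) (λ j → M k j * w j))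

·ᵥ-- : ∀ {r c} (M : Matℤ r c) u w k → (M ·ᵥ (u -ᵥ w)) k ≡ (M ·ᵥ u) k - (M ·ᵥ w) k
·ᵥ-- M u w k = trans (sumFin-cong (λ j → distrib (M k j) (u j) (w j)))
        (sumFin-- (λ j → M k j * u j) (λ j → M k j * w j))
  where
  distrib : ∀ a b c → a * (b - c) ≡ a * b - a * c
  distrib = solve-∀

-- Conformal integers

-- u ⊑ v unfolds to ∀ j → Conformal (u j) (v j).
Conformal : ℤ → ℤ → Set
Conformal a b = 0ℤ ≤ a * b × ∣ a ∣ ℕ.≤ ∣ b ∣

TrivialPart : ℤ → ℤ → Set
TrivialPart a b = a ≡ 0ℤ ⊎ a ≡ b

trivialPart? : ∀ a b → Dec (TrivialPart a b)
trivialPart? a b = a ℤP.≟ 0ℤ ⊎-dec a ℤP.≟ b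

conformal⇒between : ∀ {a b} → Conformal a b → (0ℤ ≤ a × a ≤ b) ⊎ (b ≤ a × a ≤ 0ℤ)
conformal⇒between {+ p}       {+ q}       (_ , p≤q)     = inj₁ (+≤+ z≤n , +≤+ p≤q)
conformal⇒between {+ zero}    { -[1+ q ]} _             = inj₂ (-≤+ , +≤+ z≤n)
conformal⇒between {+ suc p}   { -[1+ q ]} (() , _)
conformal⇒between { -[1+ p ]} {+ zero}    (_ , ())
conformal⇒between { -[1+ p ]} {+ suc q}   (() , _)
conformal⇒between { -[1+ p ]} { -[1+ q ]} (_ , s≤s p≤q) = inj₂ (-≤- p≤q , -≤+)

between⇒conformal : ∀ {a b} → (0ℤ ≤ a × a ≤ b) ⊎ (b ≤ a × a ≤ 0ℤ) → Conformal a b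
between⇒conformal {+ p}       {+ q}       (inj₁ (_ , +≤+ p≤q)) =
  subst (0ℤ ≤_) (ℤP.pos-* p q) (+≤+ z≤n) , p≤q
between⇒conformal {+ zero}                (inj₂ _)             = +≤+ z≤n , z≤n
between⇒conformal { -[1+ p ]} { -[1+ q ]} (inj₂ (-≤- p≤q , _)) = +≤+ z≤n , s≤s p≤q
between⇒conformal {+ suc p}               (inj₂ (_ , +≤+ ()))

conformal-zero : ∀ {a} → Conformal a 0ℤ → a ≡ 0ℤ
conformal-zero (_ , a≤0) = ℤP.∣i∣≡0⇒i≡0 (ℕP.n≤0⇒n≡0 a≤0)

conformal-complement : ∀ {a b} → Conformal a b → Conformal (b - a) b
conformal-complement {a} {b} ab with conformal⇒between {a} ab
... | inj₁ (0≤a , a≤b) =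
  between⇒conformal {b - a} (inj₁ (ℤP.i≤j⇒0≤j-i a≤b , ℤP.i-j≤i b a {{nonNegative 0≤a}}))
... | inj₂ (b≤a , a≤0) =
  between⇒conformal {b - a} (inj₂ (ℤP.i≤i+j b (- a) {{nonNegative (ℤP.neg-mono-≤ a≤0)}} ,
                                   ℤP.i≤j⇒i-j≤0 b≤a))

conformal∧≢⇒∣∣< : ∀ {a b} → Conformal a b → a ≢ b → ∣ a ∣ ℕ.< ∣ b ∣
conformal∧≢⇒∣∣< {+ p}       {+ q}       (_ , p≤q)     a≢b = ℕP.≤∧≢⇒< p≤q (a≢b ∘ cong (+_))
conformal∧≢⇒∣∣< {+ zero}    { -[1+ q ]} _             _   = s≤s z≤n
conformal∧≢⇒∣∣< {+ suc p}   { -[1+ q ]} (() , _)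
conformal∧≢⇒∣∣< { -[1+ p ]} {+ zero}    (_ , ())
conformal∧≢⇒∣∣< { -[1+ p ]} {+ suc q}   (() , _)
conformal∧≢⇒∣∣< { -[1+ p ]} { -[1+ q ]} (_ , s≤s p≤q) a≢b = s≤s (ℕP.≤∧≢⇒< p≤q (a≢b ∘ cong -[1+_]))

◃-conformal : ∀ b {t} → t ℕ.≤ ∣ b ∣ → Conformal (sign b ◃ t) b
◃-conformal (+ q)     {zero}  _   = +≤+ z≤n , z≤n
◃-conformal (+ q)     {suc t} t≤q = subst (0ℤ ≤_) (ℤP.pos-* (suc t) q) (+≤+ z≤n) , t≤q
◃-conformal -[1+ q ]  {zero}  _   = +≤+ z≤n , z≤n
◃-conformal -[1+ q ]  {suc t} t≤q = +≤+ z≤n , t≤q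

conformal⇒◃ : ∀ {a b} → Conformal a b → sign b ◃ ∣ a ∣ ≡ a
conformal⇒◃ {+ p}       {+ q}       _        = ℤP.+◃n≡+n p
conformal⇒◃ {+ zero}    { -[1+ q ]} _        = refl
conformal⇒◃ {+ suc p}   { -[1+ q ]} (() , _)
conformal⇒◃ { -[1+ p ]} {+ zero}    (_ , ())
conformal⇒◃ { -[1+ p ]} {+ suc q}   (() , _)
conformal⇒◃ { -[1+ p ]} { -[1+ q ]} _        = refl

conformal-via-trivial : ∀ {a b c} → Conformal a b → TrivialPart b c → Conformal a c
conformal-via-trivial {a} {c = c} ab (inj₁ refl) =
  subst (λ a → Conformal a c) (sym (conformal-zero {a} ab)) (+≤+ z≤n , z≤n)
conformal-via-trivial ab (inj₂ refl) = ab

nontrivial-via-trivial : ∀ {a b c} → Conformal a b → TrivialPart b c →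
                         ¬ TrivialPart a b → ¬ TrivialPart a c
nontrivial-via-trivial ab (inj₁ refl) ¬triv = ⊥-elim (¬triv (inj₁ (conformal-zero ab)))
nontrivial-via-trivial ab (inj₂ refl) ¬triv = ¬triv

private
  nonNeg*nonNeg : ∀ {a b} → 0ℤ ≤ a → 0ℤ ≤ b → 0ℤ ≤ a * b
  nonNeg*nonNeg {+ p} {+ q} _ _ = subst (0ℤ ≤_) (ℤP.pos-* p q) (+≤+ z≤n)

  nonPos*nonPos : ∀ {a b} → a ≤ 0ℤ → b ≤ 0ℤ → 0ℤ ≤ a * b
  nonPos*nonPos {+ zero}                _        _        = +≤+ z≤n
  nonPos*nonPos { -[1+ p ]} {+ zero}    _        _        =
    subst (0ℤ ≤_) (sym (ℤP.*-zeroʳ -[1+ p ])) (+≤+ z≤n)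
  nonPos*nonPos { -[1+ p ]} { -[1+ q ]} _        _        = +≤+ z≤n
  nonPos*nonPos { -[1+ p ]} {+ suc q}   _        (+≤+ ())
  nonPos*nonPos {+ suc p}               (+≤+ ())

  pos*pos : ∀ {a b} → 0ℤ < a → 0ℤ < b → 0ℤ < a * b
  pos*pos {+ suc p} {+ suc q} _         _         = +<+ (s≤s z≤n)
  pos*pos {+ zero}            (+<+ ())
  pos*pos {+ suc p} {+ zero}  _         (+<+ ())

  neg*neg : ∀ {a b} → a < 0ℤ → b < 0ℤ → 0ℤ < a * b
  neg*neg { -[1+ p ]} { -[1+ q ]} _        _        = +<+ (s≤s z≤n)
  neg*neg {+ p}                   (+<+ ())
  neg*neg { -[1+ p ]} {+ q}       _        (+<+ ())

  square-nonNeg : ∀ a → 0ℤ ≤ a * a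
  square-nonNeg (+ p)     = nonNeg*nonNeg {+ p} (+≤+ z≤n) (+≤+ z≤n)
  square-nonNeg -[1+ p ]  = +≤+ z≤n

conformal⇒gain-nonNeg : ∀ {h v} → Conformal h v → 0ℤ ≤ h * (v - h)
conformal⇒gain-nonNeg {h} {v} hv with conformal⇒between {h} {v} hv
... | inj₁ (0≤h , h≤v) = nonNeg*nonNeg 0≤h (ℤP.i≤j⇒0≤j-i h≤v)
... | inj₂ (v≤h , h≤0) = nonPos*nonPos h≤0 (ℤP.i≤j⇒i-j≤0 v≤h)

nontrivial⇒gain-pos : ∀ {h v} → Conformal h v → ¬ TrivialPart h v → 0ℤ < h * (v - h)
nontrivial⇒gain-pos {h} {v} hv ¬triv = positive (conformal⇒between {h} {v} hv)
  where
  h≢0 : h ≢ 0ℤ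
  h≢0 = ¬triv ∘ inj₁

  v-h≢0 : v - h ≢ 0ℤ
  v-h≢0 = ¬triv ∘ inj₂ ∘ sym ∘ ℤP.i-j≡0⇒i≡j v h

  positive : (0ℤ ≤ h × h ≤ v) ⊎ (v ≤ h × h ≤ 0ℤ) → 0ℤ < h * (v - h)
  positive (inj₁ (0≤h , h≤v)) =
    pos*pos (ℤP.≤∧≢⇒< 0≤h (h≢0 ∘ sym)) (ℤP.≤∧≢⇒< (ℤP.i≤j⇒0≤j-i h≤v) (v-h≢0 ∘ sym))
  positive (inj₂ (v≤h , h≤0)) =
    neg*neg (ℤP.≤∧≢⇒< h≤0 h≢0) (ℤP.≤∧≢⇒< (ℤP.i≤j⇒i-j≤0 v≤h) v-h≢0)

exchange-nonNeg : ∀ {a b h} → 0ℤ ≤ a → 0ℤ ≤ b → Conformal h (a - b) → 0ℤ ≤ a - h × 0ℤ ≤ b + h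
exchange-nonNeg {a} {b} {h} 0≤a 0≤b hv with conformal⇒between {h} hv
... | inj₁ (0≤h , h≤a-b) =
  subst (0ℤ ≤_) (sym (split-a a b h)) (ℤP.+-mono-≤ (ℤP.i≤j⇒0≤j-i h≤a-b) 0≤b) ,
  ℤP.+-mono-≤ 0≤b 0≤h
  where
  split-a : ∀ a b h → a - h ≡ ((a - b) - h) + b
  split-a = solve-∀
... | inj₂ (a-b≤h , h≤0) =
  ℤP.+-mono-≤ 0≤a (ℤP.neg-mono-≤ h≤0) ,
  subst (0ℤ ≤_) (sym (split-b a b h)) (ℤP.+-mono-≤ (ℤP.i≤j⇒0≤j-i a-b≤h) 0≤a)
  where
  split-b : ∀ a b h → b + h ≡ (h - (a - b)) + a
  split-b = solve-∀

-- Conformal kernel parts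

∃-conformal? : ∀ {Q : ℤ → Set} → Decidable Q → ∀ b → Dec (∃[ a ] (Conformal a b × Q a))
∃-conformal? {Q} Q? b = map′ fromFin toFin (FinP.any? {n = suc ∣ b ∣} (λ t → Q? (sign b ◃ toℕ t)))
  where
  fromFin : ∃[ t ] Q (sign b ◃ toℕ {suc ∣ b ∣} t) → ∃[ a ] (Conformal a b × Q a)
  fromFin (t , q) = sign b ◃ toℕ t , ◃-conformal b (FinP.toℕ≤pred[n] t) , q

  toFin : ∃[ a ] (Conformal a b × Q a) → ∃[ t ] Q (sign b ◃ toℕ {suc ∣ b ∣} t)
  toFin (a , ab , q) = fromℕ< (s≤s (proj₂ ab)) , subst Q (sym b◃t≡a) q
    where
    b◃t≡a = trans (cong (sign b ◃_) (FinP.toℕ-fromℕ< (s≤s (proj₂ ab)))) (conformal⇒◃ {a} ab)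

∃-⊑? : ∀ {n} {P : Vecℤ n → Set} → (∀ {u w} → u ≗ w → P u → P w) → Decidable P →
       ∀ v → Dec (∃[ u ] (u ⊑ v × P u))
∃-⊑? {zero} resp P? v = map′ (λ p → [] , (λ ()) , p) (λ (u , _ , p) → resp {u} (λ ()) p) (P? [])
∃-⊑? {suc n} {P} resp P? v =
  map′ cons uncons (∃-conformal? (λ a → ∃-⊑? (resp-cons a) (P? ∘ (a ∷_)) (v ∘ suc)) (v zero))
  where
  resp-cons : ∀ a {u w} → u ≗ w → P (a ∷ u) → P (a ∷ w)
  resp-cons a u≗w = resp λ { zero → refl ; (suc k) → u≗w k }

  cons : ∃[ a ] (Conformal a (v zero) × ∃[ u ] (u ⊑ (v ∘ suc) × P (a ∷ u))) → ∃[ u ] (u ⊑ v × P u)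
  cons (a , a⊑ , u , u⊑ , p) = a ∷ u , (λ { zero → a⊑ ; (suc k) → u⊑ k }) , p

  uncons : ∃[ u ] (u ⊑ v × P u) → ∃[ a ] (Conformal a (v zero) × ∃[ u ] (u ⊑ (v ∘ suc) × P (a ∷ u)))
  uncons (u , u⊑v , p) =
    u zero , u⊑v zero , u ∘ suc , u⊑v ∘ suc , resp (λ { zero → refl ; (suc k) → refl }) p

⊑∧≉⇒‖‖₁< : ∀ {n} {z w : Vecℤ n} → z ⊑ w → ¬ (z ≗ w) → ‖ z ‖₁ ℕ.< ‖ w ‖₁
⊑∧≉⇒‖‖₁< {n} {z} {w} z⊑w z≉w with FinP.¬∀⟶∃¬ n (λ k → z k ≡ w k) (λ k → z k ℤP.≟ w k) z≉w
... | k , zk≢wk = sum-mono-< (λ l → proj₂ (z⊑w l)) k (conformal∧≢⇒∣∣< {z k} (z⊑w k) zk≢wk)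

kernel-- : ∀ {r c} (M : Matℤ r c) u w → InKernel M u → InKernel M w → InKernel M (u -ᵥ w)
kernel-- M u w Mu≡0 Mw≡0 k = trans (·ᵥ-- M u w k) (cong₂ _-_ (Mu≡0 k) (Mw≡0 k))

kernel-resp : ∀ {r c} (M : Matℤ r c) {u w} → u ≗ w → InKernel M u → InKernel M w
kernel-resp M u≗w Mu≡0 k = trans (sumFin-cong (λ j → cong (M k j *_) (sym (u≗w j)))) (Mu≡0 k)

NontrivialPart : ∀ {s n} → Matℤ s n → Vecℤ n → Set
NontrivialPart B w = ∃[ h ] (InKernel B h × h ⊑ w × ∃[ k ] ¬ TrivialPart (h k) (w k))

module _ {n s} (B : Matℤ s n) {g} (bound : GraverInfBound B g) where

  proper-kernel-part : ∀ {w j} → InKernel B w → g ℕ.< ∣ w j ∣ →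
                       ∃[ z ] (z ⊑ w × InKernel B z × z j ≢ 0ℤ × ¬ (z ≗ w))
  proper-kernel-part {w} {j} Bw≡0 big with ∃-⊑? resp candidate? w
    where
    Candidate : Vecℤ n → Set
    Candidate u = InKernel B u × u j ≢ 0ℤ × ¬ (u ≗ w)

    resp : ∀ {u u′} → u ≗ u′ → Candidate u → Candidate u′
    resp {u} u≗u′ (Bu≡0 , uj≢0 , u≉w) =
      kernel-resp B {u} u≗u′ Bu≡0 , uj≢0 ∘ trans (u≗u′ j) ,
      λ u′≗w → u≉w (λ k → trans (u≗u′ k) (u′≗w k))

    candidate? : Decidable Candidate
    candidate? u =
      FinP.all? (λ k → (B ·ᵥ u) k ℤP.≟ 0ℤ) ×-dec ¬? (u j ℤP.≟ 0ℤ) ×-dec ¬? (≗-dec ℤP._≟_ u w)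
  ... | yes found = found
  ... | no none = ⊥-elim (ℕP.<⇒≱ big (bound w (Bw≡0 , w≉0 , minimal) j))
    where
    wj≢0 : w j ≢ 0ℤ
    wj≢0 wj≡0 = ℕP.<⇒≱ big (subst (λ a → ∣ a ∣ ℕ.≤ g) (sym wj≡0) z≤n)

    w≉0 : NonZeroVec w
    w≉0 w≗0 = wj≢0 (w≗0 j)

    rigid : ∀ z → z ⊑ w → InKernel B z → z j ≢ 0ℤ → z ≗ w
    rigid z z⊑w Bz≡0 zj≢0 =
      decidable-stable (≗-dec ℤP._≟_ z w) (λ z≉w → none (z , z⊑w , Bz≡0 , zj≢0 , z≉w))

    cancel : ∀ {a b} → a - b ≡ a → b ≡ 0ℤ
    cancel {a} {b} a-b≡a = trans (b≡a-[a-b] a b) (trans (cong (_-_ a) a-b≡a) (ℤP.+-inverseʳ a))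
      where
      b≡a-[a-b] : ∀ a b → b ≡ a - (a - b)
      b≡a-[a-b] = solve-∀

    -- A part vanishing at j is traded for its conformal complement w - z.
    minimal : ∀ z → InKernel B z → NonZeroVec z → z ⊑ w → z ≗ w
    minimal z Bz≡0 z≉0 z⊑w with z j ℤP.≟ 0ℤ
    ... | no zj≢0 = rigid z z⊑w Bz≡0 zj≢0
    ... | yes zj≡0 = ⊥-elim (z≉0 (λ k → cancel (w-z≗w k)))
      where
      w-z≗w : (w -ᵥ z) ≗ w
      w-z≗w = rigid (w -ᵥ z) (λ k → conformal-complement {z k} (z⊑w k)) (kernel-- B w z Bw≡0 Bz≡0)
                (wj≢0 ∘ trans (sym (trans (cong (_-_ (w j)) zj≡0) (ℤP.+-identityʳ (w j)))))

  nontrivial-kernel-part-acc : ∀ {j} w → Acc ℕ._<_ ‖ w ‖₁ → InKernel B w → g ℕ.< ∣ w j ∣ →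
                               NontrivialPart B w
  nontrivial-kernel-part-acc {j} w (acc rec) Bw≡0 big with proper-kernel-part Bw≡0 big
  ... | z , z⊑w , Bz≡0 , zj≢0 , z≉w with FinP.all? (λ k → trivialPart? (z k) (w k))
  ...   | no ¬restriction =
    z , Bz≡0 , z⊑w , FinP.¬∀⟶∃¬ n _ (λ k → trivialPart? (z k) (w k)) ¬restriction
  ...   | yes restriction = lift (nontrivial-kernel-part-acc z (rec (⊑∧≉⇒‖‖₁< z⊑w z≉w)) Bz≡0 big′)
    where
    big′ : g ℕ.< ∣ z j ∣
    big′ = subst (λ a → g ℕ.< ∣ a ∣) (sym ([ ⊥-elim ∘ zj≢0 , id ]′ (restriction j))) big

    lift : NontrivialPart B z → NontrivialPart B w
    lift (h , Bh≡0 , h⊑z , k , ¬triv) =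
      h , Bh≡0 , (λ l → conformal-via-trivial {h l} (h⊑z l) (restriction l)) ,
      k , nontrivial-via-trivial {h k} (h⊑z k) (restriction k) ¬triv

  nontrivial-kernel-part : ∀ {j} w → InKernel B w → g ℕ.< ∣ w j ∣ → NontrivialPart B w
  nontrivial-kernel-part w = nontrivial-kernel-part-acc w (<-wellFounded ‖ w ‖₁)

-- Exchanges between blocks

exchange : ∀ {m n} → (Fin m → Vecℤ n) → Fin m → Fin m → Vecℤ n → Fin m → Vecℤ n
exchange x i i′ h = updateAt (updateAt x i (_-ᵥ h)) i′ (_+ᵥ h)

Φ : ∀ {m n} → (Fin m → Vecℤ n) → ℤ
Φ x = sumFin (λ i → ‖ x i ‖²)

Φ-nonNeg : ∀ {m n} (x : Fin m → Vecℤ n) → 0ℤ ≤ Φ x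
Φ-nonNeg x =
  sumFin-nonNeg (λ i → ‖ x i ‖²) (λ i → sumFin-nonNeg (λ j → x i j * x i j) (square-nonNeg ∘ x i))

Balanced : ∀ {m n} → (Fin m → Vecℤ n) → ℕ → Set
Balanced y bnd = ∀ i i′ → NormInfLe (λ j → y i j - y i′ j) bnd

module _ {m n} {x : Fin m → Vecℤ n} {i i′ : Fin m} (i′≢i : i′ ≢ i) (h : Vecℤ n) where

  exchange-All : ∀ (P : Vecℤ n → Set) → (∀ k → P (x k)) → P (x i -ᵥ h) → P (x i′ +ᵥ h) →
                 ∀ k → P (exchange x i i′ h k)
  exchange-All P Px Pxi-h Pxi′+h =
    updateAt-All P (updateAt x i (_-ᵥ h)) i′ (updateAt-All P x i Px Pxi-h)
      (subst (P ∘ (_+ᵥ h)) (sym (updateAt-minimal i′ i x i′≢i)) Pxi′+h)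

  sumFin-exchange : ∀ (F : Vecℤ n → ℤ) →
    sumFin (F ∘ x) ≡
    sumFin (F ∘ exchange x i i′ h) + ((F (x i′) - F (x i′ +ᵥ h)) + (F (x i) - F (x i -ᵥ h)))
  sumFin-exchange F = begin
    sumFin (F ∘ x)                      ≡⟨ sumFin-updateAt F x i (_-ᵥ h) ⟩
    sumFin (F ∘ x′) + Δᵢ                ≡⟨ cong (_+ Δᵢ) (sumFin-updateAt F x′ i′ (_+ᵥ h)) ⟩
    (sumFin (F ∘ y) + Δ′ (x′ i′)) + Δᵢ  ≡⟨ cong (λ u → (sumFin (F ∘ y) + Δ′ u) + Δᵢ) x′i′≡xi′ ⟩
    (sumFin (F ∘ y) + Δ′ (x i′)) + Δᵢ   ≡⟨ ℤP.+-assoc (sumFin (F ∘ y)) (Δ′ (x i′)) Δᵢ ⟩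
    sumFin (F ∘ y) + (Δ′ (x i′) + Δᵢ)   ∎
    where
    open ≡-Reasoning
    x′ = updateAt x i (_-ᵥ h)
    x′i′≡xi′ = updateAt-minimal i′ i x i′≢i
    y  = exchange x i i′ h
    Δᵢ = F (x i) - F (x i -ᵥ h)
    Δ′ : Vecℤ n → ℤ
    Δ′ u = F u - F (u +ᵥ h)

  sumFin-exchange-entry : ∀ j → sumFin (λ k → exchange x i i′ h k j) ≡ sumFin (λ k → x k j)
  sumFin-exchange-entry j =
    sym (trans (sumFin-exchange (λ u → u j)) (cancel _ (x i j) (x i′ j) (h j)))
    where
    cancel : ∀ s a b h → s + ((b - (b + h)) + (a - (a - h))) ≡ s
    cancel = solve-∀

‖‖²-exchange : ∀ {n} (a b h : Vecℤ n) →
  (‖ b ‖² - ‖ b +ᵥ h ‖²) + (‖ a ‖² - ‖ a -ᵥ h ‖²) ≡ sumFin (λ j → + 2 * (h j * ((a j - b j) - h j)))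
‖‖²-exchange a b h =
  trans (cong₂ _+_ (‖‖²-- b (b +ᵥ h)) (‖‖²-- a (a -ᵥ h)))
    (trans (sym (sumFin-+ (λ j → b j * b j - (b j + h j) * (b j + h j))
                          (λ j → a j * a j - (a j - h j) * (a j - h j))))
      (sumFin-cong (λ j → gain-identity (a j) (b j) (h j))))
  where
  gain-identity : ∀ a b h →
    (b * b - (b + h) * (b + h)) + (a * a - (a - h) * (a - h)) ≡ + 2 * (h * ((a - b) - h))
  gain-identity = solve-∀

exchange-decreases-Φ : ∀ {m n} {x : Fin m → Vecℤ n} {i i′} → i′ ≢ i → ∀ h → h ⊑ (x i -ᵥ x i′) →
                       ∃[ k ] ¬ TrivialPart (h k) (x i k - x i′ k) → Φ (exchange x i i′ h) < Φ x
exchange-decreases-Φ {n = n} {x} {i} {i′} i′≢i h h⊑v (k , nontrivial) =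
  begin-strict
    Φ y                ≡⟨ ℤP.+-identityʳ (Φ y) ⟨
    Φ y + 0ℤ           <⟨ ℤP.+-monoʳ-< (Φ y) 0<gain ⟩
    Φ y + sumFin gain  ≡⟨ Φx≡Φy+gain ⟨
    Φ x                ∎
  where
  open ℤP.≤-Reasoning
  y = exchange x i i′ h
  gain : Fin n → ℤ
  gain j = + 2 * (h j * ((x i j - x i′ j) - h j))

  Φx≡Φy+gain : Φ x ≡ Φ y + sumFin gain
  Φx≡Φy+gain =
    trans (sumFin-exchange i′≢i h ‖_‖²) (cong (_+_ (Φ y)) (‖‖²-exchange (x i) (x i′) h))

  0<gain : 0ℤ < sumFin gain
  0<gain = sumFin-pos gain
    (λ j → ℤP.*-monoˡ-≤-nonNeg (+ 2) (conformal⇒gain-nonNeg {h j} (h⊑v j))) k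
    (ℤP.*-monoˡ-<-pos (+ 2) (nontrivial⇒gain-pos {h k} (h⊑v k) nontrivial))

module _ {d m s : ℕ} (B : Matℤ s (suc d)) (b0 : Vecℤ d) (c : Vecℤ s) where

  Feasible : (Fin m → Vecℤ (suc d)) → Set
  Feasible x = (∀ i → NonNeg (x i)) × NFoldSolution d m s B b0 c x

  exchange-feasible : ∀ {x i i′} → i′ ≢ i → ∀ h → InKernel B h → h ⊑ (x i -ᵥ x i′) →
                      Feasible x → Feasible (exchange x i i′ h)
  exchange-feasible {x} {i} {i′} i′≢i h Bh≡0 h⊑v (x≥0 , top , blocks) = y≥0 , top′ , blocks′
    where
    y = exchange x i i′ h

    y≥0 : ∀ k → NonNeg (y k)
    y≥0 = exchange-All i′≢i h NonNeg x≥0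
      (λ j → proj₁ (exchange-nonNeg (x≥0 i j) (x≥0 i′ j) (h⊑v j)))
      (λ j → proj₂ (exchange-nonNeg (x≥0 i j) (x≥0 i′ j) (h⊑v j)))

    blocks′ : ∀ k r → (B ·ᵥ y k) r ≡ c r
    blocks′ = exchange-All i′≢i h (λ u → ∀ r → (B ·ᵥ u) r ≡ c r) blocks
      (λ r → trans (·ᵥ-- B (x i) h r) (trans (cong₂ _-_ (blocks i r) (Bh≡0 r)) c+0≡c))
      (λ r → trans (·ᵥ-+ B (x i′) h r) (trans (cong₂ _+_ (blocks i′ r) (Bh≡0 r)) c+0≡c))
      where
      c+0≡c : ∀ {r} → c r + 0ℤ ≡ c r
      c+0≡c = ℤP.+-identityʳ _

    top′ : ∀ j → sumFin (λ k → y k (inject₁ j)) ≡ b0 j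
    top′ j = trans (sumFin-exchange-entry i′≢i h (inject₁ j)) (top j)

  module _ {g} (bound : GraverInfBound B g) where

    unbalanced⇒smaller-Φ : ∀ {x i i′ j} → Feasible x → g ℕ.< ∣ x i j - x i′ j ∣ →
                           ∃[ y ] (Feasible y × Φ y < Φ x)
    unbalanced⇒smaller-Φ {x} {i} {i′} {j} fx@(_ , _ , blocks) big =
      exchange-along (nontrivial-kernel-part B bound {j} (x i -ᵥ x i′) Bv≡0 big)
      where
      Bv≡0 : InKernel B (x i -ᵥ x i′)
      Bv≡0 r = trans (·ᵥ-- B (x i) (x i′) r)
                 (trans (cong₂ _-_ (blocks i r) (blocks i′ r)) (ℤP.+-inverseʳ (c r)))

      i′≢i : i′ ≢ i
      i′≢i refl = ℕP.<⇒≱ big (subst (λ a → ∣ a ∣ ℕ.≤ g) (sym (ℤP.+-inverseʳ (x i j))) z≤n)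

      exchange-along : NontrivialPart B (x i -ᵥ x i′) → ∃[ y ] (Feasible y × Φ y < Φ x)
      exchange-along (h , Bh≡0 , h⊑v , nontrivial) =
        exchange x i i′ h , exchange-feasible {x} i′≢i h Bh≡0 h⊑v fx ,
        exchange-decreases-Φ {x = x} i′≢i h h⊑v nontrivial

    balance-acc : ∀ x → Acc ℕ._<_ ∣ Φ x ∣ → Feasible x → ∃[ y ] (Feasible y × Balanced y g)
    balance-acc x (acc rec) fx
      with FinP.any? (λ i → FinP.any? (λ i′ → FinP.any? (λ j → ¬? (∣ x i j - x i′ j ∣ ℕ.≤? g))))
    ... | no none = x , fx , λ i i′ j → decidable-stable (_ ℕ.≤? g) (λ ≰ → none (i , i′ , j , ≰))
    ... | yes (i , i′ , j , ≰) = continue (unbalanced⇒smaller-Φ fx (ℕP.≰⇒> ≰))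
      where
      continue : ∃[ y ] (Feasible y × Φ y < Φ x) → ∃[ y ] (Feasible y × Balanced y g)
      continue (y , fy , Φy<Φx) = balance-acc y (rec (∣∣-mono-<-nonNeg (Φ-nonNeg y) Φy<Φx)) fy

    balance : ∀ x → Feasible x → ∃[ y ] (Feasible y × Balanced y g)
    balance x = balance-acc x (<-wellFounded ∣ Φ x ∣)

lemma5 : (d m s : ℕ) (B : Matℤ s (suc d)) (g : ℕ) → GraverInfBound B g →
    (b0 : Vecℤ d) (c : Vecℤ s) → NonNeg b0 → NonNeg c →
    (x : Fin m → Vecℤ (suc d)) → (∀ i → NonNeg (x i)) → NFoldSolution d m s B b0 c x →
    Σ (Fin m → Vecℤ (suc d)) (λ y →
      (∀ i → NonNeg (y i)) × NFoldSolution d m s B b0 c y ×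
      (∀ i i′ → NormInfLe (λ j → y i j - y i′ j) (2 ℕ.* d ℕ.* g)))
lemma5 zero zero _ _ _ _ _ _ _ _ x x≥0 sol = x , x≥0 , sol , λ ()
lemma5 zero (suc m) _ _ _ _ _ _ _ _ x x≥0 (_ , blocks) =
  (λ _ → x zero) , (λ _ → x≥0 zero) , ((λ ()) , (λ _ → blocks zero)) ,
  λ _ _ j → ℕP.≤-reflexive (cong ∣_∣ (ℤP.+-inverseʳ (x zero j)))
lemma5 (suc d) m s B g bound b0 c _ _ x x≥0 sol with balance B b0 c bound x (x≥0 , sol)
... | y , (y≥0 , soly) , balanced =
  y , y≥0 , soly , λ i i′ j → ℕP.≤-trans (balanced i i′ j) (ℕP.m≤n*m g (2 ℕ.* suc d))
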